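{- Let $P$ be a parallelogram in $\mathbb{R}^2$ whose vertices have integer coordinates. Then: if the area of $P$ is even, $\langle\partial P\rangle=0$; if the area of $P$ is odd, $\langle\partial P\rangle\in\{\pm(\sigma_2+\sigma_3),\pm(\sigma_3+\sigma_1),\pm(\sigma_1+\sigma_2)\}$.
   Context: $K_4$ is the complete graph on vertices $X_1=(0,0),X_2=(0,1),X_3=(1,0),X_4=(1,1)\in\mathbb{Z}_2\times\mathbb{Z}_2$, viewed as a $1$-dimensional simplicial complex. $H_1(K_4,\mathbb{Z})\cong\mathbb{Z}^3$ is freely generated by the cycles $\sigma_1=X_1X_2+X_2X_3+X_3X_1$, $\sigma_2=X_1X_3+X_3X_4+X_4X_1$, $\sigma_3=X_3X_2+X_4X_3+X_2X_4$ (sums of oriented edges). For a closed broken line $L$ with integer vertices, reducing coordinates mod $2$ and extending linearly on edges gives a simplicial map $L\to K_4$, and $\langle L\rangle$ denotes the image in $H_1(K_4,\mathbb{Z})$ of the generator of $H_1(L,\mathbb{Z})\cong\mathbb{Z}$ (the class of the closed broken line traversed once). $\partial P$ is the boundary of $P$ as a closed broken line. -}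

module Defs where

open import Data.Bool using (Bool; true; false)
open import Data.Nat as ℕ using (ℕ)
open import Data.Integer using (ℤ; +_; 0ℤ; 1ℤ; _+_; _-_; _*_; -_; _%ℕ_; ∣_∣)
open import Data.Product using (_×_; _,_; proj₁; proj₂)
open import Data.List using (List; []; _∷_; _++_; [_])
open import Relation.Binary.PropositionalEquality using (_≡_)

Point : Set
Point = ℤ × ℤ

-- Vertices of K₄, i.e. the elements of ℤ₂ × ℤ₂:
-- X1 = (0,0), X2 = (0,1), X3 = (1,0), X4 = (1,1).
data V : Set where
  X1 X2 X3 X4 : V

odd : ℤ → Bool
odd x = (x %ℕ 2) ℕ.≡ᵇ 1

fromBits : Bool → Bool → V
fromBits false false = X1
fromBits false true  = X2
fromBits true  false = X3
fromBits true  true  = X4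

red : Point → V
red (x , y) = fromBits (odd x) (odd y)

-- the six (unoriented) edges {Xi,Xj}, i<j, of K₄; each carries the
-- reference orientation Xi → Xj with i < j
data Edge : Set where
  e12 e13 e14 e23 e24 e34 : Edge

lo hi : Edge → V
lo e12 = X1
lo e13 = X1
lo e14 = X1
lo e23 = X2
lo e24 = X2
lo e34 = X3
hi e12 = X2
hi e13 = X3
hi e14 = X4
hi e23 = X3
hi e24 = X4
hi e34 = X4

δ : V → V → ℤ
δ X1 X1 = 1ℤ
δ X2 X2 = 1ℤ
δ X3 X3 = 1ℤ
δ X4 X4 = 1ℤ
δ _  _  = 0ℤ

-- Simplicial 1-chains of K₄ with ℤ coefficients.  Since K₄ is
-- 1-dimensional, H₁(K₄,ℤ) is the group of 1-cycles inside C₁.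
Chain : Set
Chain = Edge → ℤ

0c : Chain
0c _ = 0ℤ

_+c_ : Chain → Chain → Chain
(c +c d) e = c e + d e

-c_ : Chain → Chain
(-c c) e = - c e

infixl 6 _+c_
infix 4 _≈_

_≈_ : Chain → Chain → Set
c ≈ d = ∀ e → c e ≡ d e

-- the oriented edge XiXj as a chain (= − XjXi; degenerate edge XiXi = 0)
[_⇒_] : V → V → Chain
[ i ⇒ j ] e = δ i (lo e) * δ j (hi e) - δ i (hi e) * δ j (lo e)

σ₁ σ₂ σ₃ : Chain
σ₁ = [ X1 ⇒ X2 ] +c [ X2 ⇒ X3 ] +c [ X3 ⇒ X1 ]
σ₂ = [ X1 ⇒ X3 ] +c [ X3 ⇒ X4 ] +c [ X4 ⇒ X1 ]
σ₃ = [ X3 ⇒ X2 ] +c [ X4 ⇒ X3 ] +c [ X2 ⇒ X4 ]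

-- image of an (open) broken line p₀p₁…pₙ under the mod-2 simplicial map
pathChain : List Point → Chain
pathChain []               = 0c
pathChain (p ∷ [])         = 0c
pathChain (p ∷ q ∷ rest)   = [ red p ⇒ red q ] +c pathChain (q ∷ rest)

-- ⟨L⟩ for the closed broken line L = p₀p₁…pₙp₀ traversed once
⟨_⟩ : List Point → Chain
⟨ [] ⟩     = 0c
⟨ p ∷ ps ⟩ = pathChain ((p ∷ ps) ++ [ p ])

_-p_ : Point → Point → Point
(a , b) -p (c , d) = (a - c , b - d)

det : Point → Point → ℤ
det (a , b) (c , d) = a * d - b * c

-- ABCD (vertices listed in cyclic order) is a parallelogram: A + C = B + D
-- componentwise and the area is nonzero.
IsParallelogram : Point → Point → Point → Point → Set
IsParallelogram A B C D =
  (proj₁ A + proj₁ C ≡ proj₁ B + proj₁ D) ×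
  (proj₂ A + proj₂ C ≡ proj₂ B + proj₂ D) ×
  (det (B -p A) (D -p A) ≡ 0ℤ → Data.Empty.⊥)
  where import Data.Empty

area : Point → Point → Point → Point → ℕ
area A B C D = ∣ det (B -p A) (D -p A) ∣

-- Reduction mod 2 is a ring homomorphism ℤ → 𝔽₂, so both ⟨∂P⟩ and the parity of the
-- area only depend on the residues of A, B, C in ℤ₂ × ℤ₂ = V, that of D being A + C − B.
-- For each of the 64 residue triples the claim is then a finite computation in C₁(K₄).
module Submission where

open import Defs
open import Data.Bool using (Bool; true; false; _∧_; _xor_)
open import Data.Bool.Properties using (¬-not)
open import Data.Nat as ℕ using (suc)
import Data.Nat.Divisibility as ℕ
open import Data.Nat.Divisibility using (_∣_)
open import Data.Integer using (ℤ; +_; _+_; _-_; _*_; -_; _%ℕ_; _/ℕ_; ∣_∣)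
open import Data.Integer.DivMod using (a≡a%ℕn+[a/ℕn]*n; n%ℕd<d)
open import Data.Integer.Divisibility.Signed as ℤ∣
  using (divides; ∣ᵤ⇒∣; ∣⇒∣ᵤ; ∣m∣n⇒∣m+n; ∣m⇒∣-m; ∣m⇒∣m*n; ∣n⇒∣m*n)
import Data.Integer.Properties as ℤ
open import Data.Integer.Tactic.RingSolver using (solve-∀)
open import Data.List using (List; []; _∷_)
open import Data.List.Membership.Propositional using (_∈_)
open import Data.List.Relation.Unary.Any using (here; there)
import Data.List.Relation.Unary.All as All
open import Data.List.Relation.Unary.All using (all?)
open import Data.Product using (_×_; _,_)
open import Data.Sum using (_⊎_)
open import Data.Unit using (tt)
open import Function using (_∘_; _$_)
open import Relation.Nullary using (¬_; Dec; contradiction)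
open import Relation.Nullary.Decidable using (map′; _⊎-dec_; toWitness)
open import Relation.Binary.PropositionalEquality

infix 4 _≡₂_

record _≡₂_ (x y : ℤ) : Set where
  constructor mod₂
  field divides-difference : + 2 ℤ∣.∣ x - y

≡₂-sym : ∀ {x y} → x ≡₂ y → y ≡₂ x
≡₂-sym {x} {y} (mod₂ 2∣x-y) = mod₂ $ subst (+ 2 ℤ∣.∣_) (identity x y) (∣m⇒∣-m 2∣x-y)
  where
  identity : ∀ x y → - (x - y) ≡ y - x
  identity = solve-∀

≡₂-trans : ∀ {x y z} → x ≡₂ y → y ≡₂ z → x ≡₂ z
≡₂-trans {x} {y} {z} (mod₂ 2∣x-y) (mod₂ 2∣y-z) = mod₂ $
  subst (+ 2 ℤ∣.∣_) (identity x y z) (∣m∣n⇒∣m+n 2∣x-y 2∣y-z)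
  where
  identity : ∀ x y z → (x - y) + (y - z) ≡ x - z
  identity = solve-∀

≡₂-+ : ∀ {x y u v} → x ≡₂ y → u ≡₂ v → x + u ≡₂ y + v
≡₂-+ {x} {y} {u} {v} (mod₂ 2∣x-y) (mod₂ 2∣u-v) = mod₂ $
  subst (+ 2 ℤ∣.∣_) (identity x y u v) (∣m∣n⇒∣m+n 2∣x-y 2∣u-v)
  where
  identity : ∀ x y u v → (x - y) + (u - v) ≡ (x + u) - (y + v)
  identity = solve-∀

≡₂-neg : ∀ {x y} → x ≡₂ y → - x ≡₂ - y
≡₂-neg {x} {y} (mod₂ 2∣x-y) = mod₂ $ subst (+ 2 ℤ∣.∣_) (identity x y) (∣m⇒∣-m 2∣x-y)
  where
  identity : ∀ x y → - (x - y) ≡ - x - - y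
  identity = solve-∀

≡₂-* : ∀ {x y u v} → x ≡₂ y → u ≡₂ v → x * u ≡₂ y * v
≡₂-* {x} {y} {u} {v} (mod₂ 2∣x-y) (mod₂ 2∣u-v) = mod₂ $
  subst (+ 2 ℤ∣.∣_) (identity x y u v) (∣m∣n⇒∣m+n (∣m⇒∣m*n u 2∣x-y) (∣n⇒∣m*n y 2∣u-v))
  where
  identity : ∀ x y u v → (x - y) * u + y * (u - v) ≡ x * u - y * v
  identity = solve-∀

bit : Bool → ℤ
bit false = + 0
bit true  = + 1

cancel-remainder : ∀ {x} r q → x ≡ r + q * + 2 → x - r ≡ q * + 2
cancel-remainder r q refl = identity r q
  where
  identity : ∀ r q → r + q * + 2 - r ≡ q * + 2
  identity = solve-∀

≡₂-bit-odd : ∀ x → x ≡₂ bit (odd x)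
≡₂-bit-odd x with x %ℕ 2 | n%ℕd<d x 2 | a≡a%ℕn+[a/ℕn]*n x 2
... | 0           | _                 | x≡0+2q = mod₂ (divides (x /ℕ 2) (cancel-remainder (+ 0) (x /ℕ 2) x≡0+2q))
... | 1           | _                 | x≡1+2q = mod₂ (divides (x /ℕ 2) (cancel-remainder (+ 1) (x /ℕ 2) x≡1+2q))
... | suc (suc _) | ℕ.s≤s (ℕ.s≤s ()) | _

2∤1 : ¬ (2 ∣ 1)
2∤1 2∣1 with ℕ.∣1⇒≡1 2∣1
... | ()

bit-injective₂ : ∀ {a b} → bit a ≡₂ bit b → a ≡ b
bit-injective₂ {false} {false} _           = refl
bit-injective₂ {true}  {true}  _           = refl
bit-injective₂ {false} {true}  (mod₂ 2∣-1) = contradiction (∣⇒∣ᵤ 2∣-1) 2∤1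
bit-injective₂ {true}  {false} (mod₂ 2∣1)  = contradiction (∣⇒∣ᵤ 2∣1) 2∤1

odd-cong : ∀ {x y} → x ≡₂ y → odd x ≡ odd y
odd-cong {x} {y} x≡y =
  bit-injective₂ (≡₂-trans (≡₂-sym (≡₂-bit-odd x)) (≡₂-trans x≡y (≡₂-bit-odd y)))

odd-+ : ∀ x y → odd (x + y) ≡ odd x xor odd y
odd-+ x y = trans (odd-cong (≡₂-+ (≡₂-bit-odd x) (≡₂-bit-odd y))) (odd-bit-+ (odd x) (odd y))
  where
  odd-bit-+ : ∀ a b → odd (bit a + bit b) ≡ a xor b
  odd-bit-+ false false = refl
  odd-bit-+ false true  = refl
  odd-bit-+ true  false = refl
  odd-bit-+ true  true  = refl

odd-neg : ∀ x → odd (- x) ≡ odd x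
odd-neg x = trans (odd-cong (≡₂-neg (≡₂-bit-odd x))) (odd-bit-neg (odd x))
  where
  odd-bit-neg : ∀ a → odd (- bit a) ≡ a
  odd-bit-neg false = refl
  odd-bit-neg true  = refl

odd-- : ∀ x y → odd (x - y) ≡ odd x xor odd y
odd-- x y = trans (odd-+ x (- y)) (cong (odd x xor_) (odd-neg y))

odd-* : ∀ x y → odd (x * y) ≡ odd x ∧ odd y
odd-* x y = trans (odd-cong (≡₂-* (≡₂-bit-odd x) (≡₂-bit-odd y))) (odd-bit-* (odd x) (odd y))
  where
  odd-bit-* : ∀ a b → odd (bit a * bit b) ≡ a ∧ b
  odd-bit-* false false = refl
  odd-bit-* false true  = refl
  odd-bit-* true  false = refl
  odd-bit-* true  true  = refl

2∣∣x∣⇒odd≡false : ∀ x → 2 ∣ ∣ x ∣ → odd x ≡ false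
2∣∣x∣⇒odd≡false x 2∣x =
  odd-cong {x} {+ 0} (mod₂ (subst (+ 2 ℤ∣.∣_) (sym (ℤ.+-identityʳ x)) (∣ᵤ⇒∣ 2∣x)))

odd≡false⇒2∣∣x∣ : ∀ x → odd x ≡ false → 2 ∣ ∣ x ∣
odd≡false⇒2∣∣x∣ x even =
  ∣⇒∣ᵤ (subst (+ 2 ℤ∣.∣_) (trans (cong (λ b → x - bit b) even) (ℤ.+-identityʳ x))
              (_≡₂_.divides-difference (≡₂-bit-odd x)))

_+p_ : Point → Point → Point
(a , b) +p (c , d) = (a + c , b + d)

x-bit y-bit : V → Bool
x-bit X1 = false
x-bit X2 = false
x-bit X3 = true
x-bit X4 = true
y-bit X1 = false
y-bit X2 = true
y-bit X3 = false
y-bit X4 = true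

x-bit-fromBits : ∀ p q → x-bit (fromBits p q) ≡ p
x-bit-fromBits false false = refl
x-bit-fromBits false true  = refl
x-bit-fromBits true  false = refl
x-bit-fromBits true  true  = refl

y-bit-fromBits : ∀ p q → y-bit (fromBits p q) ≡ q
y-bit-fromBits false false = refl
y-bit-fromBits false true  = refl
y-bit-fromBits true  false = refl
y-bit-fromBits true  true  = refl

_⊕_ : V → V → V
u ⊕ v = fromBits (x-bit u xor x-bit v) (y-bit u xor y-bit v)

infixl 6 _⊕_

det₂ : V → V → Bool
det₂ u v = (x-bit u ∧ y-bit v) xor (y-bit u ∧ x-bit v)

fromBits-⊕ : ∀ p q r s → fromBits p q ⊕ fromBits r s ≡ fromBits (p xor r) (q xor s)
fromBits-⊕ p q r s
  rewrite x-bit-fromBits p q | y-bit-fromBits p q | x-bit-fromBits r s | y-bit-fromBits r s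
  = refl

fromBits-det₂ : ∀ p q r s → det₂ (fromBits p q) (fromBits r s) ≡ (p ∧ s) xor (q ∧ r)
fromBits-det₂ p q r s
  rewrite x-bit-fromBits p q | y-bit-fromBits p q | x-bit-fromBits r s | y-bit-fromBits r s
  = refl

red-+ : ∀ P Q → red (P +p Q) ≡ red P ⊕ red Q
red-+ (a , b) (c , d) =
  trans (cong₂ fromBits (odd-+ a c) (odd-+ b d)) (sym (fromBits-⊕ (odd a) (odd b) (odd c) (odd d)))

red-- : ∀ P Q → red (P -p Q) ≡ red P ⊕ red Q
red-- (a , b) (c , d) =
  trans (cong₂ fromBits (odd-- a c) (odd-- b d)) (sym (fromBits-⊕ (odd a) (odd b) (odd c) (odd d)))

odd-det : ∀ P Q → odd (det P Q) ≡ det₂ (red P) (red Q)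
odd-det (a , b) (c , d) = begin
  odd (a * d - b * c)                      ≡⟨ odd-- (a * d) (b * c) ⟩
  odd (a * d) xor odd (b * c)              ≡⟨ cong₂ _xor_ (odd-* a d) (odd-* b c) ⟩
  (odd a ∧ odd d) xor (odd b ∧ odd c)      ≡⟨ fromBits-det₂ (odd a) (odd b) (odd c) (odd d) ⟨
  det₂ (red (a , b)) (red (c , d))         ∎
  where open ≡-Reasoning

fourth-vertex : ∀ A B C D → IsParallelogram A B C D → D ≡ (A +p C) -p B
fourth-vertex (a₁ , a₂) (b₁ , b₂) _ _ (h₁ , h₂ , _) =
  cong₂ _,_ (solve-for-d a₁ b₁ h₁) (solve-for-d a₂ b₂ h₂)
  where
  solve-for-d : ∀ a b {c d} → a + c ≡ b + d → d ≡ a + c - b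
  solve-for-d a b {d = d} h = trans (identity b d) (cong (_- b) (sym h))
    where
    identity : ∀ b d → d ≡ b + d - b
    identity = solve-∀

red-fourth-vertex : ∀ A B C D → IsParallelogram A B C D → red D ≡ red A ⊕ red C ⊕ red B
red-fourth-vertex A B C D para = begin
  red D                    ≡⟨ cong red (fourth-vertex A B C D para) ⟩
  red ((A +p C) -p B)      ≡⟨ red-- (A +p C) B ⟩
  red (A +p C) ⊕ red B     ≡⟨ cong (_⊕ red B) (red-+ A C) ⟩
  red A ⊕ red C ⊕ red B    ∎
  where open ≡-Reasoning

-- ⟨ A ∷ B ∷ C ∷ D ∷ [] ⟩ unfolds definitionally to cycle (red A) (red B) (red C) (red D).
cycle : V → V → V → V → Chain
cycle a b c d = [ a ⇒ b ] +c ([ b ⇒ c ] +c ([ c ⇒ d ] +c ([ d ⇒ a ] +c 0c)))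

IsTwoGeneratorSum : Chain → Set
IsTwoGeneratorSum c =
  (c ≈ σ₂ +c σ₃ ⊎ c ≈ -c (σ₂ +c σ₃)) ⊎
  (c ≈ σ₃ +c σ₁ ⊎ c ≈ -c (σ₃ +c σ₁)) ⊎
  (c ≈ σ₁ +c σ₂ ⊎ c ≈ -c (σ₁ +c σ₂))

ParityClass : Bool → Chain → Set
ParityClass false c = c ≈ 0c
ParityClass true  c = IsTwoGeneratorSum c

module _ {A : Set} {enum : List A} (complete : ∀ x → x ∈ enum) where

  ∀-dec : {P : A → Set} → (∀ x → Dec (P x)) → Dec (∀ x → P x)
  ∀-dec P? = map′ (λ all x → All.lookup all (complete x)) (λ f → All.tabulate (λ {x} _ → f x))
                  (all? P? enum)

V-complete : ∀ v → v ∈ X1 ∷ X2 ∷ X3 ∷ X4 ∷ []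
V-complete X1 = here refl
V-complete X2 = there (here refl)
V-complete X3 = there (there (here refl))
V-complete X4 = there (there (there (here refl)))

Edge-complete : ∀ e → e ∈ e12 ∷ e13 ∷ e14 ∷ e23 ∷ e24 ∷ e34 ∷ []
Edge-complete e12 = here refl
Edge-complete e13 = there (here refl)
Edge-complete e14 = there (there (here refl))
Edge-complete e23 = there (there (there (here refl)))
Edge-complete e24 = there (there (there (there (here refl))))
Edge-complete e34 = there (there (there (there (there (here refl)))))

infix 4 _≈?_

_≈?_ : ∀ c d → Dec (c ≈ d)
c ≈? d = ∀-dec Edge-complete (λ e → c e ℤ.≟ d e)

isTwoGeneratorSum? : ∀ c → Dec (IsTwoGeneratorSum c)
isTwoGeneratorSum? c =
  (c ≈? σ₂ +c σ₃ ⊎-dec c ≈? -c (σ₂ +c σ₃)) ⊎-dec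
  (c ≈? σ₃ +c σ₁ ⊎-dec c ≈? -c (σ₃ +c σ₁)) ⊎-dec
  (c ≈? σ₁ +c σ₂ ⊎-dec c ≈? -c (σ₁ +c σ₂))

parityClass? : ∀ b c → Dec (ParityClass b c)
parityClass? false c = c ≈? 0c
parityClass? true  c = isTwoGeneratorSum? c

residue-parallelogram-class : ∀ a b c → let d = a ⊕ c ⊕ b in
  ParityClass (det₂ (b ⊕ a) (d ⊕ a)) (cycle a b c d)
residue-parallelogram-class = toWitness {a? = ∀-dec V-complete λ a → ∀-dec V-complete λ b →
  ∀-dec V-complete λ c → parityClass? (det₂ (b ⊕ a) (a ⊕ c ⊕ b ⊕ a)) (cycle a b c (a ⊕ c ⊕ b))} tt

parallelogram-parity-class : ∀ A B C D → IsParallelogram A B C D →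
  ParityClass (odd (det (B -p A) (D -p A))) (cycle (red A) (red B) (red C) (red D))
parallelogram-parity-class A B C D para =
  subst₂ ParityClass (sym parity) (cong (cycle (red A) (red B) (red C)) (sym red-D))
    (residue-parallelogram-class (red A) (red B) (red C))
  where
  red-D : red D ≡ red A ⊕ red C ⊕ red B
  red-D = red-fourth-vertex A B C D para
  parity : odd (det (B -p A) (D -p A)) ≡ det₂ (red B ⊕ red A) (red A ⊕ red C ⊕ red B ⊕ red A)
  parity = begin
    odd (det (B -p A) (D -p A))              ≡⟨ odd-det (B -p A) (D -p A) ⟩
    det₂ (red (B -p A)) (red (D -p A))       ≡⟨ cong₂ det₂ (red-- B A) (red-- D A) ⟩
    det₂ (red B ⊕ red A) (red D ⊕ red A)     ≡⟨ cong (λ d → det₂ (red B ⊕ red A) (d ⊕ red A)) red-D ⟩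
    det₂ (red B ⊕ red A) (red A ⊕ red C ⊕ red B ⊕ red A) ∎
    where open ≡-Reasoning

even-class : ∀ {b c} → ParityClass b c → b ≡ false → c ≈ 0c
even-class class refl = class

odd-class : ∀ {b c} → ParityClass b c → b ≡ true → IsTwoGeneratorSum c
odd-class class refl = class

lemma4 : (A B C D : Point) → IsParallelogram A B C D →
    (2 ∣ area A B C D → ⟨ A ∷ B ∷ C ∷ D ∷ [] ⟩ ≈ 0c) ×
    (¬ (2 ∣ area A B C D) →
      (⟨ A ∷ B ∷ C ∷ D ∷ [] ⟩ ≈ σ₂ +c σ₃ ⊎ ⟨ A ∷ B ∷ C ∷ D ∷ [] ⟩ ≈ -c (σ₂ +c σ₃)) ⊎
      (⟨ A ∷ B ∷ C ∷ D ∷ [] ⟩ ≈ σ₃ +c σ₁ ⊎ ⟨ A ∷ B ∷ C ∷ D ∷ [] ⟩ ≈ -c (σ₃ +c σ₁)) ⊎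
      (⟨ A ∷ B ∷ C ∷ D ∷ [] ⟩ ≈ σ₁ +c σ₂ ⊎ ⟨ A ∷ B ∷ C ∷ D ∷ [] ⟩ ≈ -c (σ₁ +c σ₂)))
lemma4 A B C D para =
  (λ 2∣area → even-class class (2∣∣x∣⇒odd≡false Δ 2∣area)) ,
  (λ 2∤area → odd-class class (¬-not (2∤area ∘ odd≡false⇒2∣∣x∣ Δ)))
  where
  Δ : ℤ
  Δ = det (B -p A) (D -p A)
  class : ParityClass (odd Δ) ⟨ A ∷ B ∷ C ∷ D ∷ [] ⟩
  class = parallelogram-parity-class A B C D para
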